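{- Let $p$ be a prime with $p\mid n$, let $e\in\mathbb N$, and let $\{R_j\}_{j\in J}$ be a system of representatives of the right cosets in $\Gamma_0(p^{e+1}n)\backslash\Gamma_0(pn)$, i.e. $\Gamma_0(pn)=\bigsqcup_{j}\Gamma_0(p^{e+1}n)R_j$. Then the matrices $\overline{R_j}=B_pR_jB_p^{ -1}$, $j\in J$, form a system of representatives of the right cosets in $\Gamma_0(p^en)\backslash\Gamma_0(n)$.
   Context: $B_p=\begin{pmatrix}p&0\\0&1\end{pmatrix}$; $\Gamma_0(N)=\{\begin{pmatrix}a&b\\c&d\end{pmatrix}\in SL(2,\mathbb Z):N\mid c\}$. For $g\in\Gamma_0(pn)$, $B_pgB_p^{ -1}$ lies in $\Gamma_0(n,p)=\{\begin{pmatrix}a&b\\c&d\end{pmatrix}\in SL(2,\mathbb Z):n\mid c,\ p\mid b\}\subset\Gamma_0(n)$. -}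

module Defs where

open import Data.Nat using (ℕ)
open import Data.Integer using (ℤ; +_; _+_; _-_; _*_)
open import Data.Integer.Divisibility using (_∣_)
open import Data.Product using (Σ; _×_; ∃)
open import Relation.Binary.PropositionalEquality using (_≡_)

record Mat : Set where
  constructor mat
  field
    a b c d : ℤ
open Mat public

_·_ : Mat → Mat → Mat
mat a₁ b₁ c₁ d₁ · mat a₂ b₂ c₂ d₂ =
  mat (a₁ * a₂ + b₁ * c₂) (a₁ * b₂ + b₁ * d₂)
      (c₁ * a₂ + d₁ * c₂) (c₁ * b₂ + d₁ * d₂)

det : Mat → ℤ
det m = a m * d m - b m * c m

InSL2 : Mat → Set
InSL2 m = det m ≡ + 1

InΓ₀ : ℕ → Mat → Set
InΓ₀ N m = InSL2 m × (+ N ∣ c m)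

B : ℕ → Mat
B p = mat (+ p) (+ 0) (+ 0) (+ 1)

InCoset : ℕ → Mat → Mat → Set
InCoset N R g = Σ Mat λ h → InΓ₀ N h × (g ≡ h · R)

IsCosetReps : ℕ → ℕ → {J : Set} → (J → Mat) → Set
IsCosetReps M N {J} R =
  ((j : J) → InΓ₀ N (R j)) ×
  ((g : Mat) → InΓ₀ N g →
     Σ J λ j → InCoset M (R j) g × ((j' : J) → InCoset M (R j') g → j' ≡ j))

{-# OPTIONS --safe #-}
module Submission where

-- Conjugation by B_p, (a b ; c d) ↦ (a pb ; c/p d), is multiplicative and maps Γ₀(pN)
-- onto the matrices of Γ₀(N) whose upper right entry is divisible by p.  Hence it sends
-- Γ₀(p^(e+1) n)-cosets inside Γ₀(pn) injectively to Γ₀(p^e n)-cosets inside Γ₀(n).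
-- Every coset is reached: since p ∣ c, the product ad = 1 + bc is invertible modulo p^e,
-- so each g ∈ Γ₀(n) factors as h · (1 0 ; w 1) with h ∈ Γ₀(p^e n) and n ∣ w, and
-- (1 0 ; w 1) is the conjugate of (1 0 ; pw 1) ∈ Γ₀(pn), which lies in some Γ₀(p^(e+1) n) R_j.

open import Defs
open import Data.Nat as ℕ using (ℕ; NonZero)
open import Data.Nat.Primality using (Prime; prime⇒nonZero)
open import Data.Product using (Σ; _×_; _,_; proj₁; proj₂; map₂)
open import Relation.Binary.PropositionalEquality
  using (_≡_; refl; sym; trans; cong; cong₂; subst; subst₂; module ≡-Reasoning)

module Matrix where
  open import Data.Integer using (ℤ; +_; -_; _+_; _-_; _*_)
  open import Data.Integer.Tactic.RingSolver using (solve-∀)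
  open ≡-Reasoning

  I : Mat
  I = mat (+ 1) (+ 0) (+ 0) (+ 1)

  lower : ℤ → Mat
  lower w = mat (+ 1) (+ 0) w (+ 1)

  adj : Mat → Mat
  adj X = mat (d X) (- b X) (- c X) (a X)

  mat-cong : ∀ {a₁ b₁ c₁ d₁ a₂ b₂ c₂ d₂} →
             a₁ ≡ a₂ → b₁ ≡ b₂ → c₁ ≡ c₂ → d₁ ≡ d₂ → mat a₁ b₁ c₁ d₁ ≡ mat a₂ b₂ c₂ d₂
  mat-cong refl refl refl refl = refl

  ·-assoc : ∀ X Y Z → (X · Y) · Z ≡ X · (Y · Z)
  ·-assoc (mat a₁ b₁ c₁ d₁) (mat a₂ b₂ c₂ d₂) (mat a₃ b₃ c₃ d₃) =
    mat-cong (row-col a₁ b₁ a₂ b₂ c₂ d₂ a₃ c₃) (row-col a₁ b₁ a₂ b₂ c₂ d₂ b₃ d₃)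
             (row-col c₁ d₁ a₂ b₂ c₂ d₂ a₃ c₃) (row-col c₁ d₁ a₂ b₂ c₂ d₂ b₃ d₃)
    where
    row-col : ∀ x y a₂ b₂ c₂ d₂ u v → (x * a₂ + y * c₂) * u + (x * b₂ + y * d₂) * v ≡
                                      x * (a₂ * u + b₂ * v) + y * (c₂ * u + d₂ * v)
    row-col = solve-∀

  ·-identityˡ : ∀ X → I · X ≡ X
  ·-identityˡ (mat a₁ b₁ c₁ d₁) = mat-cong (first a₁ c₁) (first b₁ d₁) (second a₁ c₁) (second b₁ d₁)
    where
    first : ∀ x y → + 1 * x + + 0 * y ≡ x
    first = solve-∀
    second : ∀ x y → + 0 * x + + 1 * y ≡ y
    second = solve-∀

  ·-identityʳ : ∀ X → X · I ≡ X
  ·-identityʳ (mat a₁ b₁ c₁ d₁) = mat-cong (first a₁ b₁) (second a₁ b₁) (first c₁ d₁) (second c₁ d₁)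
    where
    first : ∀ x y → x * + 1 + y * + 0 ≡ x
    first = solve-∀
    second : ∀ x y → x * + 0 + y * + 1 ≡ y
    second = solve-∀

  det-· : ∀ X Y → det (X · Y) ≡ det X * det Y
  det-· (mat a₁ b₁ c₁ d₁) (mat a₂ b₂ c₂ d₂) = binet a₁ b₁ c₁ d₁ a₂ b₂ c₂ d₂
    where
    binet : ∀ a₁ b₁ c₁ d₁ a₂ b₂ c₂ d₂ →
      (a₁ * a₂ + b₁ * c₂) * (c₁ * b₂ + d₁ * d₂) - (a₁ * b₂ + b₁ * d₂) * (c₁ * a₂ + d₁ * c₂)
        ≡ (a₁ * d₁ - b₁ * c₁) * (a₂ * d₂ - b₂ * c₂)
    binet = solve-∀

  det-adj : ∀ X → det (adj X) ≡ det X
  det-adj (mat a₁ b₁ c₁ d₁) = swap a₁ b₁ c₁ d₁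
    where
    swap : ∀ a₁ b₁ c₁ d₁ → d₁ * a₁ - (- b₁) * (- c₁) ≡ a₁ * d₁ - b₁ * c₁
    swap = solve-∀

  adj-inverseˡ : ∀ {X} → InSL2 X → adj X · X ≡ I
  adj-inverseˡ {mat a₁ b₁ c₁ d₁} det≡1 =
    mat-cong (trans (diag₁ a₁ b₁ c₁ d₁) det≡1) (off₁ b₁ d₁) (off₂ a₁ c₁) (trans (diag₂ a₁ b₁ c₁ d₁) det≡1)
    where
    diag₁ : ∀ a₁ b₁ c₁ d₁ → d₁ * a₁ + (- b₁) * c₁ ≡ a₁ * d₁ - b₁ * c₁
    diag₁ = solve-∀
    diag₂ : ∀ a₁ b₁ c₁ d₁ → (- c₁) * b₁ + a₁ * d₁ ≡ a₁ * d₁ - b₁ * c₁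
    diag₂ = solve-∀
    off₁ : ∀ x y → y * x + (- x) * y ≡ + 0
    off₁ = solve-∀
    off₂ : ∀ x y → (- y) * x + x * y ≡ + 0
    off₂ = solve-∀

  adj-inverseʳ : ∀ {X} → InSL2 X → X · adj X ≡ I
  adj-inverseʳ {mat a₁ b₁ c₁ d₁} det≡1 =
    mat-cong (trans (diag₁ a₁ b₁ c₁ d₁) det≡1) (off₁ a₁ b₁) (off₂ c₁ d₁) (trans (diag₂ a₁ b₁ c₁ d₁) det≡1)
    where
    diag₁ : ∀ a₁ b₁ c₁ d₁ → a₁ * d₁ + b₁ * (- c₁) ≡ a₁ * d₁ - b₁ * c₁
    diag₁ = solve-∀
    diag₂ : ∀ a₁ b₁ c₁ d₁ → c₁ * (- b₁) + d₁ * a₁ ≡ a₁ * d₁ - b₁ * c₁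
    diag₂ = solve-∀
    off₁ : ∀ x y → x * (- y) + y * x ≡ + 0
    off₁ = solve-∀
    off₂ : ∀ x y → x * y + y * (- x) ≡ + 0
    off₂ = solve-∀

  B-· : ∀ p X → B p · X ≡ mat (+ p * a X) (+ p * b X) (c X) (d X)
  B-· p (mat a₁ b₁ c₁ d₁) = mat-cong (first (+ p) a₁ c₁) (first (+ p) b₁ d₁) (second a₁ c₁) (second b₁ d₁)
    where
    first : ∀ P x y → P * x + + 0 * y ≡ P * x
    first = solve-∀
    second : ∀ x y → + 0 * x + + 1 * y ≡ y
    second = solve-∀

  ·-B : ∀ p X → X · B p ≡ mat (a X * + p) (b X) (c X * + p) (d X)
  ·-B p (mat a₁ b₁ c₁ d₁) = mat-cong (first (+ p) a₁ b₁) (second a₁ b₁) (first (+ p) c₁ d₁) (second c₁ d₁)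
    where
    first : ∀ P x y → x * P + y * + 0 ≡ x * P
    first = solve-∀
    second : ∀ x y → x * + 0 + y * + 1 ≡ y
    second = solve-∀

  x·y≡z⇒y≡adjx·z : ∀ {X Y Z} → InSL2 X → X · Y ≡ Z → Y ≡ adj X · Z
  x·y≡z⇒y≡adjx·z {X} {Y} {Z} det≡1 X·Y≡Z = begin
    Y                 ≡⟨ sym (·-identityˡ Y) ⟩
    I · Y             ≡⟨ cong (_· Y) (sym (adj-inverseˡ {X} det≡1)) ⟩
    (adj X · X) · Y   ≡⟨ ·-assoc (adj X) X Y ⟩
    adj X · (X · Y)   ≡⟨ cong (adj X ·_) X·Y≡Z ⟩
    adj X · Z         ∎

  x·y≡z⇒x≡z·adjy : ∀ {X Y Z} → InSL2 Y → X · Y ≡ Z → X ≡ Z · adj Y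
  x·y≡z⇒x≡z·adjy {X} {Y} {Z} det≡1 X·Y≡Z = begin
    X                 ≡⟨ sym (·-identityʳ X) ⟩
    X · I             ≡⟨ cong (X ·_) (sym (adj-inverseʳ {Y} det≡1)) ⟩
    X · (Y · adj Y)   ≡⟨ sym (·-assoc X Y (adj Y)) ⟩
    (X · Y) · adj Y   ≡⟨ cong (_· adj Y) X·Y≡Z ⟩
    Z · adj Y         ∎

open Matrix

module CongruenceSubgroup where
  open import Data.Integer using (ℤ; +_; -_; _+_; _-_; _*_; 1ℤ)
  open import Data.Integer.Properties using (pos-*; *-comm; *-identityʳ; *-cancelʳ-≡)
  open import Data.Integer.Divisibility.Signed
    using (_∣_; divides; ∣ᵤ⇒∣; ∣⇒∣ᵤ; ∣-trans; ∣m⇒∣-m; ∣m⇒∣m*n; ∣n⇒∣m*n; ∣m∣n⇒∣m+n;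
           *-monoˡ-∣; *-monoʳ-∣; *-cancelʳ-∣)
  open import Data.Integer.Tactic.RingSolver using (solve-∀)

  *-pres-∣ : ∀ {i j m n} → i ∣ m → j ∣ n → i * j ∣ m * n
  *-pres-∣ {j = j} {m = m} i∣m j∣n = ∣-trans (*-monoˡ-∣ j i∣m) (*-monoʳ-∣ m j∣n)

  inverse-mod-^ : ∀ {m} x → + m ∣ 1ℤ - x → ∀ k → Σ ℤ λ y → + (m ℕ.^ k) ∣ 1ℤ - x * y
  inverse-mod-^ x m∣1-x ℕ.zero = + 0 , divides (1ℤ - x * + 0) (sym (*-identityʳ _))
  inverse-mod-^ {m} x m∣1-x (ℕ.suc k) with inverse-mod-^ x m∣1-x k
  ... | y , mᵏ∣1-xy =
    1ℤ + (1ℤ - x) * y , subst₂ _∣_ (sym (pos-* m (m ℕ.^ k))) (lift x y) (*-pres-∣ m∣1-x mᵏ∣1-xy)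
    where
    lift : ∀ x y → (1ℤ - x) * (1ℤ - x * y) ≡ 1ℤ - x * (1ℤ + (1ℤ - x) * y)
    lift = solve-∀

  Γ₀-intro : ∀ {N} X → InSL2 X → + N ∣ c X → InΓ₀ N X
  Γ₀-intro _ det≡1 N∣c = det≡1 , ∣⇒∣ᵤ N∣c

  Γ₀⇒∣c : ∀ {N} X → InΓ₀ N X → + N ∣ c X
  Γ₀⇒∣c _ (_ , N∣c) = ∣ᵤ⇒∣ N∣c

  Γ₀-I : ∀ N → InΓ₀ N I
  Γ₀-I N = Γ₀-intro I refl (divides (+ 0) refl)

  Γ₀-· : ∀ {N X Y} → InΓ₀ N X → InΓ₀ N Y → InΓ₀ N (X · Y)
  Γ₀-· {X = X} {Y} X∈Γ₀ Y∈Γ₀ =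
    Γ₀-intro (X · Y) (trans (det-· X Y) (cong₂ _*_ (proj₁ X∈Γ₀) (proj₁ Y∈Γ₀)))
             (∣m∣n⇒∣m+n (∣m⇒∣m*n (a Y) (Γ₀⇒∣c X X∈Γ₀)) (∣n⇒∣m*n (d X) (Γ₀⇒∣c Y Y∈Γ₀)))

  Γ₀-adj : ∀ {N X} → InΓ₀ N X → InΓ₀ N (adj X)
  Γ₀-adj {X = X} X∈Γ₀ = Γ₀-intro (adj X) (trans (det-adj X) (proj₁ X∈Γ₀)) (∣m⇒∣-m (Γ₀⇒∣c X X∈Γ₀))

  Γ₀-lower : ∀ {N w} → + N ∣ w → InΓ₀ N (lower w)
  Γ₀-lower {w = w} = Γ₀-intro (lower w) refl

  InCoset-refl : ∀ N X → InCoset N X X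
  InCoset-refl N X = I , Γ₀-I N , sym (·-identityˡ X)

  InCoset-·ˡ : ∀ {N R g h} → InΓ₀ N h → InCoset N R g → InCoset N R (h · g)
  InCoset-·ˡ {R = R} {h = h} h∈Γ₀ (k , k∈Γ₀ , g≡k·R) =
    h · k , Γ₀-· {X = h} {k} h∈Γ₀ k∈Γ₀ , trans (cong (h ·_) g≡k·R) (sym (·-assoc h k R))

  InCoset-euclidean : ∀ {N X Y g} → InCoset N X g → InCoset N Y g → InCoset N Y X
  InCoset-euclidean {Y = Y} (h , h∈Γ₀ , g≡h·X) (k , k∈Γ₀ , g≡k·Y) =
    adj h · k , Γ₀-· {X = adj h} {k} (Γ₀-adj {X = h} h∈Γ₀) k∈Γ₀ ,
    trans (x·y≡z⇒y≡adjx·z {h} (proj₁ h∈Γ₀) (trans (sym g≡h·X) g≡k·Y)) (sym (·-assoc (adj h) k Y))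

  reps-injective : ∀ {M N J} {R : J → Mat} → IsCosetReps M N R →
                   ∀ {i j} → InCoset M (R j) (R i) → i ≡ j
  reps-injective {M} {R = R} (R∈Γ₀ , classify) {i} {j} Rᵢ∈Rⱼ =
    trans (unique i (InCoset-refl M (R i))) (sym (unique j Rᵢ∈Rⱼ))
    where
    unique : ∀ k → InCoset M (R k) (R i) → k ≡ proj₁ (classify (R i) (R∈Γ₀ i))
    unique = proj₂ (proj₂ (classify (R i) (R∈Γ₀ i)))

  LowerFactorisation : ℕ → ℕ → Mat → Set
  LowerFactorisation M N g = Σ Mat λ h → Σ ℤ λ w → InΓ₀ M h × + N ∣ w × g ≡ h · lower w

  Γ₀-lowerFactorisation : ∀ {m n g} e → + m ∣ + n → InΓ₀ n g → LowerFactorisation (m ℕ.^ e ℕ.* n) n g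
  Γ₀-lowerFactorisation {m} {n} {mat a₁ b₁ c₁ d₁} e m∣n g∈Γ₀ =
    h , w , Γ₀-intro h (trans (det-h a₁ b₁ c₁ d₁ w) det≡1) mᵉn∣c-dw , n∣w ,
    mat-cong (sym (a-entry a₁ b₁ w)) (sym (b-entry a₁ b₁ w)) (sym (a-entry c₁ d₁ w)) (sym (b-entry c₁ d₁ w))
    where
    det≡1 : a₁ * d₁ - b₁ * c₁ ≡ 1ℤ
    det≡1 = proj₁ g∈Γ₀
    n∣c : + n ∣ c₁
    n∣c = Γ₀⇒∣c (mat a₁ b₁ c₁ d₁) g∈Γ₀
    m∣1-ad : + m ∣ 1ℤ - a₁ * d₁
    m∣1-ad = subst (+ m ∣_) (trans (-bc≡det-ad a₁ b₁ c₁ d₁) (cong (_- a₁ * d₁) det≡1))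
                   (∣m⇒∣-m (∣n⇒∣m*n b₁ (∣-trans m∣n n∣c)))
      where
      -bc≡det-ad : ∀ a₁ b₁ c₁ d₁ → - (b₁ * c₁) ≡ (a₁ * d₁ - b₁ * c₁) - a₁ * d₁
      -bc≡det-ad = solve-∀
    inverse : Σ ℤ λ y → + (m ℕ.^ e) ∣ 1ℤ - a₁ * d₁ * y
    inverse = inverse-mod-^ (a₁ * d₁) m∣1-ad e
    y : ℤ
    y = proj₁ inverse
    w : ℤ
    w = c₁ * a₁ * y
    h : Mat
    h = mat (a₁ - b₁ * w) b₁ (c₁ - d₁ * w) d₁
    n∣w : + n ∣ w
    n∣w = ∣m⇒∣m*n y (∣m⇒∣m*n a₁ n∣c)
    mᵉn∣c-dw : + (m ℕ.^ e ℕ.* n) ∣ c₁ - d₁ * w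
    mᵉn∣c-dw = subst₂ _∣_ (sym (pos-* (m ℕ.^ e) n)) (c-dw a₁ c₁ d₁ y)
                      (*-pres-∣ (proj₂ inverse) n∣c)
      where
      c-dw : ∀ a₁ c₁ d₁ y → (1ℤ - a₁ * d₁ * y) * c₁ ≡ c₁ - d₁ * (c₁ * a₁ * y)
      c-dw = solve-∀
    det-h : ∀ a₁ b₁ c₁ d₁ w → (a₁ - b₁ * w) * d₁ - b₁ * (c₁ - d₁ * w) ≡ a₁ * d₁ - b₁ * c₁
    det-h = solve-∀
    a-entry : ∀ x y w → (x - y * w) * + 1 + y * w ≡ x
    a-entry = solve-∀
    b-entry : ∀ x y w → (x - y * w) * + 0 + y * + 1 ≡ y
    b-entry = solve-∀

  -- Conjugate p X Y  iff  Y = B_p X B_p⁻¹.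
  data Conjugate (p : ℕ) : Mat → Mat → Set where
    conj : ∀ a b c d → Conjugate p (mat a b (c * + p) d) (mat a (b * + p) c d)

  conjugate-intro : ∀ {p a₁ b₁ c₁ d₁ a₂ b₂ c₂ d₂} →
    a₂ ≡ a₁ → b₂ ≡ b₁ * + p → c₁ ≡ c₂ * + p → d₂ ≡ d₁ →
    Conjugate p (mat a₁ b₁ c₁ d₁) (mat a₂ b₂ c₂ d₂)
  conjugate-intro refl refl refl refl = conj _ _ _ _

  intertwining⇒Conjugate : ∀ {p X Y} .{{_ : NonZero p}} → B p · X ≡ Y · B p → Conjugate p X Y
  intertwining⇒Conjugate {p} {X@(mat a₁ b₁ c₁ d₁)} {Y@(mat a₂ b₂ c₂ d₂)} B·X≡Y·B =
    conjugate-intro (*-cancelʳ-≡ a₂ a₁ (+ p) (trans (sym (cong a entries)) (*-comm (+ p) a₁)))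
                    (trans (sym (cong b entries)) (*-comm (+ p) b₁))
                    (cong c entries)
                    (sym (cong d entries))
    where
    entries : mat (+ p * a₁) (+ p * b₁) c₁ d₁ ≡ mat (a₂ * + p) b₂ (c₂ * + p) d₂
    entries = trans (sym (B-· p X)) (trans B·X≡Y·B (·-B p Y))

  det-conjugate : ∀ {p X Y} → Conjugate p X Y → det Y ≡ det X
  det-conjugate {p} (conj a₁ b₁ c₁ d₁) = shift a₁ b₁ c₁ d₁ (+ p)
    where
    shift : ∀ a₁ b₁ c₁ d₁ P → a₁ * d₁ - b₁ * P * c₁ ≡ a₁ * d₁ - b₁ * (c₁ * P)
    shift = solve-∀

  +[p*N]≡N*p : ∀ p N → + (p ℕ.* N) ≡ + N * + p
  +[p*N]≡N*p p N = trans (pos-* p N) (*-comm (+ p) (+ N))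

  conjugate-Γ₀ : ∀ {p N X Y} .{{_ : NonZero p}} → Conjugate p X Y → InΓ₀ (p ℕ.* N) X → InΓ₀ N Y
  conjugate-Γ₀ {p} {N} X↦Y@(conj a₁ b₁ c₁ d₁) X∈Γ₀ =
    Γ₀-intro (mat a₁ (b₁ * + p) c₁ d₁) (trans (det-conjugate X↦Y) (proj₁ X∈Γ₀))
      (*-cancelʳ-∣ (+ p) (subst (_∣ c₁ * + p) (+[p*N]≡N*p p N) (Γ₀⇒∣c (mat a₁ b₁ (c₁ * + p) d₁) X∈Γ₀)))

  conjugate-Γ₀⁻¹ : ∀ {p N X Y} → Conjugate p X Y → InΓ₀ N Y → InΓ₀ (p ℕ.* N) X
  conjugate-Γ₀⁻¹ {p} {N} X↦Y@(conj a₁ b₁ c₁ d₁) Y∈Γ₀ =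
    Γ₀-intro (mat a₁ b₁ (c₁ * + p) d₁) (trans (sym (det-conjugate X↦Y)) (proj₁ Y∈Γ₀))
      (subst (_∣ c₁ * + p) (sym (+[p*N]≡N*p p N)) (*-monoˡ-∣ (+ p) (Γ₀⇒∣c (mat a₁ (b₁ * + p) c₁ d₁) Y∈Γ₀)))

  ∣c⇒conjugate : ∀ {p X} → + p ∣ c X → Σ Mat (Conjugate p X)
  ∣c⇒conjugate {p} {mat a₁ b₁ c₁ d₁} (divides q refl) = mat a₁ (b₁ * + p) q d₁ , conj a₁ b₁ q d₁

  ∣b⇒conjugate : ∀ {p Y} → + p ∣ b Y → Σ Mat λ X → Conjugate p X Y
  ∣b⇒conjugate {p} {mat a₁ b₁ c₁ d₁} (divides q refl) = mat a₁ q (c₁ * + p) d₁ , conj a₁ q c₁ d₁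

  lower-conjugate : ∀ p w → Conjugate p (lower (w * + p)) (lower w)
  lower-conjugate p w = conj (+ 1) (+ 0) w (+ 1)

  conjugate-· : ∀ {p X₁ Y₁ X₂ Y₂} → Conjugate p X₁ Y₁ → Conjugate p X₂ Y₂ →
                Conjugate p (X₁ · X₂) (Y₁ · Y₂)
  conjugate-· {p} (conj a₁ b₁ c₁ d₁) (conj a₂ b₂ c₂ d₂) =
    conjugate-intro (a-entry a₁ a₂ b₁ c₂ (+ p)) (b-entry a₁ b₂ b₁ d₂ (+ p))
                    (c-entry c₁ a₂ d₁ c₂ (+ p)) (d-entry c₁ b₂ d₁ d₂ (+ p))
    where
    a-entry : ∀ x y u v P → x * y + u * P * v ≡ x * y + u * (v * P)
    a-entry = solve-∀
    b-entry : ∀ x y u v P → x * (y * P) + u * P * v ≡ (x * y + u * v) * P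
    b-entry = solve-∀
    c-entry : ∀ x y u v P → x * P * y + u * (v * P) ≡ (x * y + u * v) * P
    c-entry = solve-∀
    d-entry : ∀ x y u v P → x * (y * P) + u * v ≡ x * P * y + u * v
    d-entry = solve-∀

  conjugate-functional : ∀ {p X Y X′ Y′} .{{_ : NonZero p}} →
    Conjugate p X Y → Conjugate p X′ Y′ → X ≡ X′ → Y ≡ Y′
  conjugate-functional {p} (conj a₁ b₁ c₁ d₁) (conj a₂ b₂ c₂ d₂) X≡X′ =
    mat-cong (cong a X≡X′) (cong (λ M → b M * + p) X≡X′)
             (*-cancelʳ-≡ c₁ c₂ (+ p) (cong c X≡X′)) (cong d X≡X′)

  conjugate-injective : ∀ {p X Y X′ Y′} .{{_ : NonZero p}} →
    Conjugate p X Y → Conjugate p X′ Y′ → Y ≡ Y′ → X ≡ X′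
  conjugate-injective {p} (conj a₁ b₁ c₁ d₁) (conj a₂ b₂ c₂ d₂) Y≡Y′ =
    mat-cong (cong a Y≡Y′) (*-cancelʳ-≡ b₁ b₂ (+ p) (cong b Y≡Y′))
             (cong (λ M → c M * + p) Y≡Y′) (cong d Y≡Y′)

  conjugate-∣b-·adj : ∀ {p X₁ Y₁ X₂ Y₂} → Conjugate p X₁ Y₁ → Conjugate p X₂ Y₂ → + p ∣ b (Y₁ · adj Y₂)
  conjugate-∣b-·adj {p} (conj a₁ b₁ c₁ d₁) (conj a₂ b₂ c₂ d₂) =
    divides (b₁ * a₂ - a₁ * b₂) (factor a₁ b₁ a₂ b₂ (+ p))
    where
    factor : ∀ a₁ b₁ a₂ b₂ P → a₁ * - (b₂ * P) + b₁ * P * a₂ ≡ (b₁ * a₂ - a₁ * b₂) * P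
    factor = solve-∀

  conjugate-coset : ∀ {p N X₁ Y₁ X₂ Y₂} .{{_ : NonZero p}} →
    Conjugate p X₁ Y₁ → Conjugate p X₂ Y₂ → InCoset (p ℕ.* N) X₂ X₁ → InCoset N Y₂ Y₁
  conjugate-coset {p} {N} X₁↦Y₁ X₂↦Y₂ (H , H∈Γ₀ , X₁≡H·X₂) with ∣c⇒conjugate {X = H} p∣cH
    where
    p∣cH : + p ∣ c H
    p∣cH = ∣-trans (divides (+ N) (+[p*N]≡N*p p N)) (Γ₀⇒∣c H H∈Γ₀)
  ... | K , H↦K =
    K , conjugate-Γ₀ H↦K H∈Γ₀ , sym (conjugate-functional (conjugate-· H↦K X₂↦Y₂) X₁↦Y₁ (sym X₁≡H·X₂))

  conjugate-coset⁻¹ : ∀ {p N X₁ Y₁ X₂ Y₂} .{{_ : NonZero p}} → InSL2 Y₂ →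
    Conjugate p X₁ Y₁ → Conjugate p X₂ Y₂ → InCoset N Y₂ Y₁ → InCoset (p ℕ.* N) X₂ X₁
  conjugate-coset⁻¹ {p} {Y₁ = Y₁} {Y₂ = Y₂} detY₂≡1 X₁↦Y₁ X₂↦Y₂ (M , M∈Γ₀ , Y₁≡M·Y₂)
    with ∣b⇒conjugate {Y = M} (subst (λ K → + p ∣ b K) (sym M≡Y₁·adjY₂) (conjugate-∣b-·adj X₁↦Y₁ X₂↦Y₂))
    where
    M≡Y₁·adjY₂ : M ≡ Y₁ · adj Y₂
    M≡Y₁·adjY₂ = x·y≡z⇒x≡z·adjy {M} {Y₂} detY₂≡1 (sym Y₁≡M·Y₂)
  ... | H , H↦M =
    H , conjugate-Γ₀⁻¹ H↦M M∈Γ₀ , sym (conjugate-injective (conjugate-· H↦M X₂↦Y₂) X₁↦Y₁ (sym Y₁≡M·Y₂))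

  module _ {p M N J} .{{_ : NonZero p}} {R R̄ : J → Mat}
           (reps : IsCosetReps (p ℕ.* M) (p ℕ.* N) R) (R↦R̄ : ∀ j → Conjugate p (R j) (R̄ j)) where

    conjugate-reps-injective : ∀ {g i j} → InCoset M (R̄ i) g → InCoset M (R̄ j) g → i ≡ j
    conjugate-reps-injective {j = j} g∈R̄ᵢ g∈R̄ⱼ =
      reps-injective reps (conjugate-coset⁻¹ det≡1 (R↦R̄ _) (R↦R̄ j) (InCoset-euclidean g∈R̄ᵢ g∈R̄ⱼ))
      where
      det≡1 : InSL2 (R̄ j)
      det≡1 = trans (det-conjugate (R↦R̄ j)) (proj₁ (proj₁ reps j))

    conjugate-reps-cover : ∀ {w} → + N ∣ w → Σ J λ j → InCoset M (R̄ j) (lower w)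
    conjugate-reps-cover {w} N∣w
      with proj₂ reps (lower (w * + p)) (conjugate-Γ₀⁻¹ (lower-conjugate p w) (Γ₀-lower N∣w))
    ... | j , Lpw∈Rⱼ , _ = j , conjugate-coset (lower-conjugate p w) (R↦R̄ j) Lpw∈Rⱼ

    conjugate-IsCosetReps : (∀ {g} → InΓ₀ N g → LowerFactorisation M N g) → IsCosetReps M N R̄
    conjugate-IsCosetReps factor =
      (λ j → conjugate-Γ₀ (R↦R̄ j) (proj₁ reps j)) , λ g g∈Γ₀ → classify (cover (factor g∈Γ₀))
      where
      cover : ∀ {g} → LowerFactorisation M N g → Σ J λ j → InCoset M (R̄ j) g
      cover (h , w , h∈Γ₀ , N∣w , refl) = map₂ (InCoset-·ˡ {h = h} h∈Γ₀) (conjugate-reps-cover N∣w)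
      classify : ∀ {g} → Σ J (λ j → InCoset M (R̄ j) g) →
                 Σ J λ j → InCoset M (R̄ j) g × (∀ i → InCoset M (R̄ i) g → i ≡ j)
      classify (j , g∈R̄ⱼ) = j , g∈R̄ⱼ , λ i g∈R̄ᵢ → conjugate-reps-injective g∈R̄ᵢ g∈R̄ⱼ

open CongruenceSubgroup

open import Data.Nat using (_+_; _*_; _^_)
open import Data.Nat.Properties using (+-comm; *-assoc)
open import Data.Nat.Divisibility using (_∣_)
open import Data.Integer.Divisibility.Signed using (∣ᵤ⇒∣)

lemma3p5 : (p n e : ℕ) → .{{_ : NonZero n}} → Prime p → p ∣ n →
    {J : Set} → (R Rbar : J → Mat) →
    IsCosetReps (p ^ (e + 1) * n) (p * n) R →
    ((j : J) → B p · R j ≡ Rbar j · B p) →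
    IsCosetReps (p ^ e * n) n Rbar
lemma3p5 p n e p-prime p∣n R Rbar reps B·R≡R̄·B =
  conjugate-IsCosetReps reps′ (λ j → intertwining⇒Conjugate (B·R≡R̄·B j))
                        (Γ₀-lowerFactorisation e (∣ᵤ⇒∣ p∣n))
  where
  instance
    p≢0 : NonZero p
    p≢0 = prime⇒nonZero p-prime
  reps′ : IsCosetReps (p * (p ^ e * n)) (p * n) R
  reps′ = subst (λ K → IsCosetReps K (p * n) R)
                (trans (cong (λ k → p ^ k * n) (+-comm e 1)) (*-assoc p (p ^ e) n)) reps
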